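{- Let \(\mathcal V\) be a universe. (i) There is a locally small \(\delta_{\mathcal V}\)-complete poset with decidable equality that is nontrivial in an unspecified way if and only if weak excluded middle in \(\mathcal V\) holds. (ii) There is a locally small \(\delta_{\mathcal V}\)-complete poset with decidable equality that is positive in an unspecified way if and only if excluded middle in \(\mathcal V\) holds.
   Context: Work in univalent foundations (intensional Martin-Löf type theory with universes, function and propositional extensionality, propositional truncations; \(\exists_{x:X}Y(x):=\|\Sigma_{x:X}Y(x)\|\)). A poset is a type \(X\) with a proposition-valued reflexive, transitive, antisymmetric relation \(\sqsubseteq\); it is \(\delta_{\mathcal V}\)-complete if for all \(x\sqsubseteq y\) and propositions \(P:\mathcal V\), the family \(\delta_{x,y,P}:\mathbf 1+P\to X\), \(\mathrm{inl}(\star)\mapsto x\), \(\mathrm{inr}(p)\mapsto y\), has a supremum \(\bigvee\delta_{x,y,P}\). Here \(x\) is strictly below \(y\) if \(x\sqsubseteq y\) and for every \(z\sqsupseteq y\) and proposition \(P:\mathcal V\), \(z=\bigvee\delta_{x,z,P}\) implies \(P\). Nontrivial in an unspecified way: \(\exists_{x}\exists_{y}((x\sqsubseteq y)\times(x\neq y))\); positive in an unspecified way: \(\exists_x\exists_y(x\text{ strictly below }y)\). Locally small: there is a \(\mathcal V\)-valued relation \(\sqsubseteq_{\mathcal V}\) with \((x\sqsubseteq y)\simeq(x\sqsubseteq_{\mathcal V}y)\). Decidable equality: \((x=y)+\lnot(x=y)\) for all \(x,y\). Excluded middle in \(\mathcal V\): \(P\) or \(\lnot P\) for every proposition \(P:\mathcal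 V\); weak excluded middle in \(\mathcal V\): \(\lnot P\) or \(\lnot\lnot P\) for every proposition \(P:\mathcal V\). -}

{-# OPTIONS --without-K #-}
module Defs where

open import Level using (Level; _⊔_; Setω) renaming (suc to lsuc)
open import Data.Product using (Σ; _×_; _,_; Σ-syntax)
open import Data.Sum using (_⊎_; inj₁; inj₂)
open import Data.Unit using (⊤; tt)
open import Relation.Nullary using (¬_)
open import Relation.Binary.PropositionalEquality using (_≡_)
open import Function.Bundles using (_↔_)

isProp : ∀ {ℓ} → Set ℓ → Set ℓ
isProp A = (x y : A) → x ≡ y

FunExt : Setω
FunExt = ∀ {a b} {A : Set a} {B : A → Set b} {f g : (x : A) → B x}
         → ((x : A) → f x ≡ g x) → f ≡ g

PropExt : Setω
PropExt = ∀ {ℓ} {P Q : Set ℓ} → isProp P → isProp Q → (P → Q) → (Q → P) → P ≡ Q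

record PropTrunc : Setω where
  field
    ∥_∥      : ∀ {ℓ} → Set ℓ → Set ℓ
    ∣_∣      : ∀ {ℓ} {A : Set ℓ} → A → ∥ A ∥
    ∥∥-isProp : ∀ {ℓ} {A : Set ℓ} → isProp ∥ A ∥
    ∥∥-rec   : ∀ {ℓ ℓ'} {A : Set ℓ} {B : Set ℓ'} → isProp B → (A → B) → ∥ A ∥ → B

record Poset (u t : Level) : Set (lsuc (u ⊔ t)) where
  field
    Carrier    : Set u
    _⊑_        : Carrier → Carrier → Set t
    ⊑-prop     : ∀ x y → isProp (x ⊑ y)
    ⊑-refl     : ∀ x → x ⊑ x
    ⊑-trans    : ∀ x y z → x ⊑ y → y ⊑ z → x ⊑ z
    ⊑-antisym  : ∀ x y → x ⊑ y → y ⊑ x → x ≡ y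

module _ {u t : Level} (𝑷 : Poset u t) where
  open Poset 𝑷

  isSup : ∀ {i} {I : Set i} → (I → Carrier) → Carrier → Set (u ⊔ t ⊔ i)
  isSup {I = I} α s = ((k : I) → α k ⊑ s)
                    × ((z : Carrier) → ((k : I) → α k ⊑ z) → s ⊑ z)

  δ : ∀ {v} (x y : Carrier) (P : Set v) → ⊤ ⊎ P → Carrier
  δ x y P (inj₁ _) = x
  δ x y P (inj₂ _) = y

  δ-complete : (v : Level) → Set (lsuc v ⊔ u ⊔ t)
  δ-complete v = (x y : Carrier) → x ⊑ y → (P : Set v) → isProp P
               → Σ[ s ∈ Carrier ] isSup (δ x y P) s

  strictly-below : (v : Level) → δ-complete v → Carrier → Carrier → Set (lsuc v ⊔ u ⊔ t)
  strictly-below v c x y =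
    Σ[ x⊑y ∈ x ⊑ y ] ((z : Carrier) (y⊑z : y ⊑ z) (P : Set v) (Pp : isProp P)
                      → z ≡ Σ.proj₁ (c x z (⊑-trans x y z x⊑y y⊑z) P Pp) → P)

  locally-small : (v : Level) → Set (lsuc v ⊔ u ⊔ t)
  locally-small v = Σ[ _⊑ᵥ_ ∈ (Carrier → Carrier → Set v) ] (∀ x y → (x ⊑ y) ↔ (x ⊑ᵥ y))

  has-decidable-equality : Set u
  has-decidable-equality = (x y : Carrier) → (x ≡ y) ⊎ ¬ (x ≡ y)

  module _ (pt : PropTrunc) where
    open PropTrunc pt

    nontrivial : Set (u ⊔ t)
    nontrivial = ∥ Σ[ x ∈ Carrier ] ∥ Σ[ y ∈ Carrier ] ((x ⊑ y) × ¬ (x ≡ y)) ∥ ∥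

    positive : (v : Level) → δ-complete v → Set (lsuc v ⊔ u ⊔ t)
    positive v c = ∥ Σ[ x ∈ Carrier ] ∥ Σ[ y ∈ Carrier ] strictly-below v c x y ∥ ∥

EM : (v : Level) → Set (lsuc v)
EM v = (P : Set v) → isProp P → P ⊎ ¬ P

WEM : (v : Level) → Set (lsuc v)
WEM v = (P : Set v) → isProp P → ¬ P ⊎ ¬ ¬ P

record _∧ω_ (A B : Setω) : Setω where
  constructor _,ω_
  field
    fst : A
    snd : B

NontrivialDecδPoset : PropTrunc → (v : Level) → ∀ {u t} → Poset u t → Set (lsuc v ⊔ u ⊔ t)
NontrivialDecδPoset pt v 𝑷 =
  locally-small 𝑷 v × δ-complete 𝑷 v × has-decidable-equality 𝑷 × nontrivial 𝑷 pt

PositiveDecδPoset : PropTrunc → (v : Level) → ∀ {u t} → Poset u t → Set (lsuc v ⊔ u ⊔ t)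
PositiveDecδPoset pt v 𝑷 =
  locally-small 𝑷 v × has-decidable-equality 𝑷 × Σ[ c ∈ δ-complete 𝑷 v ] positive 𝑷 pt v c

-- embedding of a small type into Setω (so it can be paired with Setω statements)
record ⟪_⟫ {ℓ} (A : Set ℓ) : Setω where
  constructor ⟪_⟫ᵢ
  field
    unwrap : A

{-# OPTIONS --safe #-}

-- In a δ-complete poset the supremum s of δ_{x,y,P} is y when P holds and x when ¬P holds. Given
-- x ⊑ y with x ≠ y, deciding s = x therefore decides ¬P (weak excluded middle); if moreover x is
-- strictly below y, deciding y = s decides P itself. Conversely the two-element poset 0 ⊑ 1 has
-- decidable equality, and the supremum of δ_{0,1,P} exists as soon as ¬P is decided: it is 0 if
-- ¬P and 1 if ¬¬P. Under excluded middle this supremum is 1 only if P holds, so 0 is strictly below 1.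
module Submission where

open import Defs
open import Level using (Level; Lift; lift; lower) renaming (suc to lsuc)
open import Data.Product using (Σ-syntax; _,_; proj₁; proj₂; _×_)
open import Data.Sum using (_⊎_; inj₁; inj₂)
open import Data.Unit using (tt)
open import Data.Empty using (⊥-elim)
open import Data.Bool using (Bool; true; false; _≤_; f≤t; b≤b)
open import Data.Bool.Properties using (≤-refl; ≤-trans; ≤-antisym; ≤-irrelevant; ≤-minimum)
open import Relation.Nullary using (¬_)
open import Relation.Binary.PropositionalEquality using (_≡_; refl; sym; trans; cong)
open import Function.Properties.Inverse using (↔-refl)

¬-isProp : FunExt → ∀ {a} {A : Set a} → isProp (¬ A)
¬-isProp fe ¬a ¬a′ = fe λ a → ⊥-elim (¬a a)

⊎-isProp : ∀ {a b} {A : Set a} {B : Set b} → isProp A → isProp B → (A → ¬ B) → isProp (A ⊎ B)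
⊎-isProp A-prop B-prop disjoint (inj₁ a) (inj₁ a′) = cong inj₁ (A-prop a a′)
⊎-isProp A-prop B-prop disjoint (inj₁ a) (inj₂ b)  = ⊥-elim (disjoint a b)
⊎-isProp A-prop B-prop disjoint (inj₂ b) (inj₁ a)  = ⊥-elim (disjoint a b)
⊎-isProp A-prop B-prop disjoint (inj₂ b) (inj₂ b′) = cong inj₂ (B-prop b b′)

em-isProp : FunExt → ∀ {a} {A : Set a} → isProp A → isProp (A ⊎ ¬ A)
em-isProp fe A-prop = ⊎-isProp A-prop (¬-isProp fe) λ a ¬a → ¬a a

wem-isProp : FunExt → ∀ {a} {A : Set a} → isProp (¬ A ⊎ ¬ ¬ A)
wem-isProp fe = ⊎-isProp (¬-isProp fe) (¬-isProp fe) λ ¬a ¬¬a → ¬¬a ¬a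

em⇒wem : ∀ {a} {A : Set a} → A ⊎ ¬ A → ¬ A ⊎ ¬ ¬ A
em⇒wem (inj₁ a)  = inj₂ λ ¬a → ¬a a
em⇒wem (inj₂ ¬a) = inj₁ ¬a

EM⇒WEM : ∀ {v} → EM v → WEM v
EM⇒WEM em P P-prop = em⇒wem (em P P-prop)

module _ (pt : PropTrunc) where
  open PropTrunc pt

  ∥Σ∥Σ∥∥-rec : ∀ {a c r b} {A : Set a} {C : Set c} {R : A → C → Set r} {B : Set b}
             → isProp B → (∀ x y → R x y → B) → ∥ Σ[ x ∈ A ] ∥ Σ[ y ∈ C ] R x y ∥ ∥ → B
  ∥Σ∥Σ∥∥-rec B-prop f = ∥∥-rec B-prop λ { (x , ∃y) → ∥∥-rec B-prop (λ { (y , r) → f x y r }) ∃y }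

module _ {u t} (𝑷 : Poset u t) where
  open Poset 𝑷

  δ-diagonal-sup : ∀ {v} (x : Carrier) (P : Set v) → isSup 𝑷 (δ 𝑷 x x P) x
  δ-diagonal-sup x P = (λ { (inj₁ _) → ⊑-refl x ; (inj₂ _) → ⊑-refl x }) , λ _ bound → bound (inj₁ tt)

  module _ {v} {x y s : Carrier} {P : Set v} (s-sup : isSup 𝑷 (δ 𝑷 x y P) s) where

    δ-sup-≡-top : x ⊑ y → P → s ≡ y
    δ-sup-≡-top x⊑y p = ⊑-antisym s y (proj₂ s-sup y y-bound) (proj₁ s-sup (inj₂ p))
      where
      y-bound : ∀ k → δ 𝑷 x y P k ⊑ y
      y-bound (inj₁ _) = x⊑y
      y-bound (inj₂ _) = ⊑-refl y

    δ-sup-≡-bottom : ¬ P → s ≡ x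
    δ-sup-≡-bottom ¬p = ⊑-antisym s x (proj₂ s-sup x x-bound) (proj₁ s-sup (inj₁ tt))
      where
      x-bound : ∀ k → δ 𝑷 x y P k ⊑ x
      x-bound (inj₁ _) = ⊑-refl x
      x-bound (inj₂ p) = ⊥-elim (¬p p)

  module _ (pt : PropTrunc) (fe : FunExt) {v : Level} where

    NontrivialDecδPoset⇒WEM : NontrivialDecδPoset pt v 𝑷 → WEM v
    NontrivialDecδPoset⇒WEM (_ , δ-sup , _≟_ , nontriv) P P-prop =
      ∥Σ∥Σ∥∥-rec pt (wem-isProp fe) decide nontriv
      where
      decide : ∀ x y → (x ⊑ y) × ¬ (x ≡ y) → ¬ P ⊎ ¬ ¬ P
      decide x y (x⊑y , x≢y) with δ-sup x y x⊑y P P-prop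
      ... | s , s-sup with s ≟ x
      ... | inj₁ s≡x = inj₁ λ p → x≢y (trans (sym s≡x) (δ-sup-≡-top s-sup x⊑y p))
      ... | inj₂ s≢x = inj₂ λ ¬p → s≢x (δ-sup-≡-bottom s-sup ¬p)

    PositiveDecδPoset⇒EM : PositiveDecδPoset pt v 𝑷 → EM v
    PositiveDecδPoset⇒EM (_ , _≟_ , δ-sup , pos) P P-prop =
      ∥Σ∥Σ∥∥-rec pt (em-isProp fe P-prop) decide pos
      where
      decide : ∀ x y → strictly-below 𝑷 v δ-sup x y → P ⊎ ¬ P
      decide x y (x⊑y , below) = top-decides (δ-sup x y _ P P-prop) (below y (⊑-refl y) P P-prop)
        where
        top-decides : (sup : Σ[ s ∈ Carrier ] isSup 𝑷 (δ 𝑷 x y P) s) → (y ≡ proj₁ sup → P) → P ⊎ ¬ P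
        top-decides (s , s-sup) y≡s⇒p with y ≟ s
        ... | inj₁ y≡s = inj₁ (y≡s⇒p y≡s)
        ... | inj₂ y≢s = inj₂ λ p → y≢s (sym (δ-sup-≡-top s-sup x⊑y p))

module TwoElementPoset (v : Level) where

  𝟚 : Poset (lsuc v) v
  𝟚 = record
    { Carrier   = Lift (lsuc v) Bool
    ; _⊑_       = λ x y → Lift v (lower x ≤ lower y)
    ; ⊑-prop    = λ { _ _ (lift p) (lift q) → cong lift (≤-irrelevant p q) }
    ; ⊑-refl    = λ _ → lift ≤-refl
    ; ⊑-trans   = λ { _ _ _ (lift p) (lift q) → lift (≤-trans p q) }
    ; ⊑-antisym = λ { _ _ (lift p) (lift q) → cong lift (≤-antisym p q) }
    }

  open Poset 𝟚

  𝟎 𝟏 : Carrier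
  𝟎 = lift false
  𝟏 = lift true

  𝟏⋢𝟎 : ¬ (𝟏 ⊑ 𝟎)
  𝟏⋢𝟎 (lift ())

  δ₀₁-sup : {P : Set v} → ¬ P ⊎ ¬ ¬ P → Carrier
  δ₀₁-sup (inj₁ _) = 𝟎
  δ₀₁-sup (inj₂ _) = 𝟏

  δ₀₁-sup-isSup : {P : Set v} (w : ¬ P ⊎ ¬ ¬ P) → isSup 𝟚 (δ 𝟚 𝟎 𝟏 P) (δ₀₁-sup w)
  δ₀₁-sup-isSup (inj₁ ¬p) = (λ { (inj₁ _) → lift b≤b ; (inj₂ p) → ⊥-elim (¬p p) }) , λ _ _ → lift (≤-minimum _)
  δ₀₁-sup-isSup {P} (inj₂ ¬¬p) = (λ { (inj₁ _) → lift f≤t ; (inj₂ _) → lift b≤b }) , least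
    where
    least : (z : Carrier) → (∀ k → δ 𝟚 𝟎 𝟏 P k ⊑ z) → 𝟏 ⊑ z
    least (lift true)  _     = lift b≤b
    least (lift false) bound = ⊥-elim (¬¬p λ p → 𝟏⋢𝟎 (bound (inj₂ p)))

  𝟚-δ-complete : WEM v → δ-complete 𝟚 v
  𝟚-δ-complete wem (lift false) (lift false) _ P _ = 𝟎 , δ-diagonal-sup 𝟚 𝟎 P
  𝟚-δ-complete wem (lift true)  (lift true)  _ P _ = 𝟏 , δ-diagonal-sup 𝟚 𝟏 P
  𝟚-δ-complete wem (lift false) (lift true)  _ P P-prop = δ₀₁-sup (wem P P-prop) , δ₀₁-sup-isSup (wem P P-prop)
  𝟚-δ-complete wem (lift true)  (lift false) 𝟏⊑𝟎 _ _ = ⊥-elim (𝟏⋢𝟎 𝟏⊑𝟎)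

  𝟚-locally-small : locally-small 𝟚 v
  𝟚-locally-small = _⊑_ , λ _ _ → ↔-refl

  _≟_ : has-decidable-equality 𝟚
  lift false ≟ lift false = inj₁ refl
  lift true  ≟ lift true  = inj₁ refl
  lift false ≟ lift true  = inj₂ λ ()
  lift true  ≟ lift false = inj₂ λ ()

  δ₀₁-sup-≡-𝟏 : {P : Set v} (d : P ⊎ ¬ P) → 𝟏 ≡ δ₀₁-sup (em⇒wem d) → P
  δ₀₁-sup-≡-𝟏 (inj₁ p) _ = p
  δ₀₁-sup-≡-𝟏 (inj₂ _) ()

  module _ (pt : PropTrunc) where
    open PropTrunc pt

    𝟚-nontrivial : nontrivial 𝟚 pt
    𝟚-nontrivial = ∣ 𝟎 , ∣ 𝟏 , lift f≤t , (λ ()) ∣ ∣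

    WEM⇒NontrivialDecδPoset : WEM v → NontrivialDecδPoset pt v 𝟚
    WEM⇒NontrivialDecδPoset wem = 𝟚-locally-small , 𝟚-δ-complete wem , _≟_ , 𝟚-nontrivial

    𝟎-strictly-below-𝟏 : (em : EM v) → strictly-below 𝟚 v (𝟚-δ-complete (EM⇒WEM em)) 𝟎 𝟏
    𝟎-strictly-below-𝟏 em = lift f≤t , below
      where
      below : ∀ z (𝟏⊑z : 𝟏 ⊑ z) (P : Set v) (P-prop : isProp P)
            → z ≡ proj₁ (𝟚-δ-complete (EM⇒WEM em) 𝟎 z (⊑-trans 𝟎 𝟏 z (lift f≤t) 𝟏⊑z) P P-prop) → P
      below (lift true)  _   P P-prop = δ₀₁-sup-≡-𝟏 (em P P-prop)
      below (lift false) 𝟏⊑𝟎 _ _      = ⊥-elim (𝟏⋢𝟎 𝟏⊑𝟎)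

    EM⇒PositiveDecδPoset : EM v → PositiveDecδPoset pt v 𝟚
    EM⇒PositiveDecδPoset em =
      𝟚-locally-small , _≟_ , 𝟚-δ-complete (EM⇒WEM em) , ∣ 𝟎 , ∣ 𝟏 , 𝟎-strictly-below-𝟏 em ∣ ∣

open TwoElementPoset using (𝟚; WEM⇒NontrivialDecδPoset; EM⇒PositiveDecδPoset)

theorem4p31 : (pt : PropTrunc) → FunExt → PropExt → (v : Level)
    -- (i)
    → ((∀ {u t} (𝑷 : Poset u t) → NontrivialDecδPoset pt v 𝑷 → WEM v)
       ∧ω ⟪ (WEM v → Σ[ 𝑷 ∈ Poset (lsuc v) v ] NontrivialDecδPoset pt v 𝑷) ⟫)
    -- (ii)
    ∧ω ((∀ {u t} (𝑷 : Poset u t) → PositiveDecδPoset pt v 𝑷 → EM v)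
       ∧ω ⟪ (EM v → Σ[ 𝑷 ∈ Poset (lsuc v) v ] PositiveDecδPoset pt v 𝑷) ⟫)
theorem4p31 pt fe _ v =
  ((λ 𝑷 → NontrivialDecδPoset⇒WEM 𝑷 pt fe)
     ,ω ⟪ (λ wem → 𝟚 v , WEM⇒NontrivialDecδPoset v pt wem) ⟫ᵢ)
  ,ω ((λ 𝑷 → PositiveDecδPoset⇒EM 𝑷 pt fe)
     ,ω ⟪ (λ em → 𝟚 v , EM⇒PositiveDecδPoset v pt em) ⟫ᵢ)
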